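{- If $(\sigma_1,\sigma_2)$ is an allowable pair of permutations in $\mathfrak{S}_n$, then the directed graph $\mathbf{G}(\sigma_1,\sigma_2)$ has no directed cycle.
   Context: For $\sigma,\gamma\in\mathfrak{S}_n$, the pair $(\sigma,\gamma)$ is allowable if (a) for all $1\le i<j\le n$, $\sigma(i)>\sigma(j)$ implies $\gamma(i)>\gamma(j)$, and (b) for all $1\le i<j<k\le n$ with $\sigma(i)<\sigma(j)<\sigma(k)$, it is not the case that $\gamma(j)<\gamma(k)<\gamma(i)$. For permutations $\sigma_1,\dots,\sigma_k\in\mathfrak{S}_n$, the directed graph $\mathbf{G}(\sigma_1,\dots,\sigma_k)$ has vertex set $\{(i,j):1\le i\le n,\,1\le j\le k\}$ (row $i$, column $j$) and edges: (1) horizontal edges $(i,j)\to(i,j+1)$ for all $1\le i\le n$, $1\le j\le k-1$; (2) vertical edges $(p,j)\to(i,j)$ for all $1\le j\le k$ and $i\ne p$ with $\sigma_j(i)<\sigma_j(p)$; (3) diagonal edges $(p,j)\to(i,j-1)$ for all $2\le j\le k$ and $1\le i<p\le n$ with $\sigma_j(i)<\sigma_j(p)$. -}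

module Defs where

open import Data.Nat using (ℕ; suc)
open import Data.Fin as Fin using (Fin; toℕ; _<_; _>_)
open import Data.Fin.Permutation using (Permutation′; _⟨$⟩ʳ_)
open import Data.Product using (_×_; _,_)
open import Data.Empty using (⊥)
open import Relation.Nullary using (¬_)
open import Relation.Binary.PropositionalEquality using (_≡_)
open import Relation.Binary.Construct.Closure.Transitive using (TransClosure)

-- Permutations of [n] are bijections of Fin n (positions and values 0-based,
-- order preserved).

Allowable : {n : ℕ} → Permutation′ n → Permutation′ n → Set
Allowable {n} σ γ =
  (∀ (i j : Fin n) → i < j → σ ⟨$⟩ʳ i > σ ⟨$⟩ʳ j → γ ⟨$⟩ʳ i > γ ⟨$⟩ʳ j)
  × (∀ (i j k : Fin n) → i < j → j < k →
       σ ⟨$⟩ʳ i < σ ⟨$⟩ʳ j → σ ⟨$⟩ʳ j < σ ⟨$⟩ʳ k →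
       ¬ ((γ ⟨$⟩ʳ j < γ ⟨$⟩ʳ k) × (γ ⟨$⟩ʳ k < γ ⟨$⟩ʳ i)))

-- Vertices of G(σ_1,…,σ_k): (row i, column j).
Vertex : ℕ → ℕ → Set
Vertex n k = Fin n × Fin k

-- Edges of G(σ_1,…,σ_k); σ j is σ_{j+1} (columns are 0-based).
data Edge {n k : ℕ} (σ : Fin k → Permutation′ n) : Vertex n k → Vertex n k → Set where
  horizontal : ∀ (i : Fin n) (j j′ : Fin k) → toℕ j′ ≡ suc (toℕ j) →
               Edge σ (i , j) (i , j′)
  vertical   : ∀ (p i : Fin n) (j : Fin k) → ¬ (i ≡ p) →
               σ j ⟨$⟩ʳ i < σ j ⟨$⟩ʳ p →
               Edge σ (p , j) (i , j)
  diagonal   : ∀ (p i : Fin n) (j j′ : Fin k) → toℕ j ≡ suc (toℕ j′) →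
               i < p → σ j ⟨$⟩ʳ i < σ j ⟨$⟩ʳ p →
               Edge σ (p , j) (i , j′)

HasDirectedCycle : {n k : ℕ} → (Fin k → Permutation′ n) → Set
HasDirectedCycle {n} {k} σ = ∃v
  where
  open import Data.Product using (∃)
  ∃v = ∃ λ (v : Vertex n k) → TransClosure (Edge σ) v v

pair : {n : ℕ} → Permutation′ n → Permutation′ n → Fin 2 → Permutation′ n
pair σ₁ σ₂ Fin.zero = σ₁
pair σ₁ σ₂ (Fin.suc _) = σ₂

-- Give row r of the right-hand column the weight μ(r) = min { σ₁(a) : σ₂(a) ≥ σ₂(r) }.
-- Ordering the vertices lexicographically by (σ₁(i), n) in the left column and by
-- (μ(r), σ₂(r)) in the right column, every edge of G(σ₁, σ₂) goes strictly downwards.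
-- Horizontal and vertical edges decrease this potential for elementary reasons; for a
-- diagonal edge (p, 2) → (i, 1) one needs σ₁(i) < σ₁(a) whenever σ₂(a) ≥ σ₂(p), and
-- this is exactly what allowability guarantees.
module Submission where

open import Defs
open import Data.Nat as ℕ using (ℕ; _≤_; _<_)
open import Data.Nat.Properties as ℕ using (<-strictPartialOrder; m≤n⇒m<n∨m≡n)
open import Data.Fin as Fin using (Fin; toℕ)
open import Data.Fin.Properties as Fin using (toℕ<n; _≤?_)
open import Data.Fin.Permutation using (Permutation′; _⟨$⟩ʳ_)
open import Data.List using (List; map; filter; allFin)
open import Data.List.Extrema.Nat using (min; min≤xs; min-mono-⊆; v<min⁺)
open import Data.List.Membership.Propositional.Properties using (∈-map⁺; ∈-filter⁺; ∈-allFin)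
open import Data.List.Relation.Binary.Subset.Propositional using (_⊆_)
open import Data.List.Relation.Binary.Subset.Propositional.Properties as Subset using (filter⁺′)
open import Data.List.Relation.Unary.All as All using (All)
open import Data.List.Relation.Unary.All.Properties using (all-filter; map⁺)
open import Data.Product using (_×_; _,_; proj₁; proj₂)
open import Data.Product.Relation.Binary.Lex.Strict using (×-strictPartialOrder)
open import Data.Sum using (inj₁; inj₂)
open import Data.Empty using (⊥-elim)
open import Function.Bundles using (Injection)
open import Function.Properties.Inverse using (↔⇒↣)
open import Relation.Binary using (Rel; StrictPartialOrder; tri<; tri≈; tri>)
open import Relation.Binary.PropositionalEquality using (_≡_; refl; sym; subst)
open import Relation.Binary.Construct.Closure.Transitive using (TransClosure; [_]; _∷_)
open import Relation.Nullary using (¬_)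

module _ {a c ℓ₁ ℓ₂ ℓ} {A : Set a} {_∼_ : Rel A ℓ} (O : StrictPartialOrder c ℓ₁ ℓ₂) where
  open StrictPartialOrder O renaming (_<_ to _≺_)

  module _ (φ : A → Carrier) (decreasing : ∀ {v w} → v ∼ w → φ w ≺ φ v) where

    decreasing⁺ : ∀ {v w} → TransClosure _∼_ v w → φ w ≺ φ v
    decreasing⁺ [ e ]    = decreasing e
    decreasing⁺ (e ∷ es) = trans (decreasing⁺ es) (decreasing e)

    acyclic : ∀ {v} → ¬ TransClosure _∼_ v v
    acyclic cycle = irrefl Eq.refl (decreasing⁺ cycle)

Lex : StrictPartialOrder _ _ _
Lex = ×-strictPartialOrder <-strictPartialOrder <-strictPartialOrder

_<ₗₑₓ_ : Rel (ℕ × ℕ) _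
_<ₗₑₓ_ = StrictPartialOrder._<_ Lex

≤-<⇒<ₗₑₓ : ∀ {x x′ y y′} → x ≤ x′ → y < y′ → (x , y) <ₗₑₓ (x′ , y′)
≤-<⇒<ₗₑₓ x≤x′ y<y′ with m≤n⇒m<n∨m≡n x≤x′
... | inj₁ x<x′ = inj₁ x<x′
... | inj₂ x≡x′ = inj₂ (x≡x′ , y<y′)

⟨$⟩ʳ-injective : ∀ {n} (π : Permutation′ n) {i j} → π ⟨$⟩ʳ i ≡ π ⟨$⟩ʳ j → i ≡ j
⟨$⟩ʳ-injective π = Injection.injective (↔⇒↣ π)

module Allowability {n : ℕ} (σ γ : Permutation′ n) (allowable : Allowable σ γ) where

  ascent-reflected : ∀ {i j} → i Fin.< j → γ ⟨$⟩ʳ i Fin.< γ ⟨$⟩ʳ j → σ ⟨$⟩ʳ i Fin.< σ ⟨$⟩ʳ j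
  ascent-reflected {i} {j} i<j γi<γj with Fin.<-cmp (σ ⟨$⟩ʳ i) (σ ⟨$⟩ʳ j)
  ... | tri< σi<σj _ _ = σi<σj
  ... | tri≈ _ σi≡σj _ = ⊥-elim (Fin.<-irrefl (⟨$⟩ʳ-injective σ σi≡σj) i<j)
  ... | tri> _ _ σj<σi = ⊥-elim (Fin.<-asym γi<γj (proj₁ allowable i j i<j σj<σi))

  -- The case a < i < p is where the forbidden pattern of allowability is used.
  ascent-below-upper-set : ∀ {i p a} → i Fin.< p → γ ⟨$⟩ʳ i Fin.< γ ⟨$⟩ʳ p →
                           γ ⟨$⟩ʳ p Fin.≤ γ ⟨$⟩ʳ a → σ ⟨$⟩ʳ i Fin.< σ ⟨$⟩ʳ a
  ascent-below-upper-set {i} {p} {a} i<p γi<γp γp≤γa with m≤n⇒m<n∨m≡n γp≤γa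
  ... | inj₂ γp≡γa =
    subst (λ b → σ ⟨$⟩ʳ i Fin.< σ ⟨$⟩ʳ b) (⟨$⟩ʳ-injective γ (Fin.toℕ-injective γp≡γa))
          (ascent-reflected i<p γi<γp)
  ... | inj₁ γp<γa with Fin.<-cmp p a
  ...   | tri< p<a _ _ = Fin.<-trans (ascent-reflected i<p γi<γp) (ascent-reflected p<a γp<γa)
  ...   | tri≈ _ refl _ = ⊥-elim (Fin.<-irrefl refl γp<γa)
  ...   | tri> _ _ a<p with Fin.<-cmp i a
  ...     | tri< i<a _ _ = ascent-reflected i<a (Fin.<-trans γi<γp γp<γa)
  ...     | tri≈ _ refl _ = ⊥-elim (Fin.<-asym γi<γp γp<γa)
  ...     | tri> _ _ a<i with Fin.<-cmp (σ ⟨$⟩ʳ i) (σ ⟨$⟩ʳ a)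
  ...       | tri< σi<σa _ _ = σi<σa
  ...       | tri≈ _ σi≡σa _ = ⊥-elim (Fin.<-irrefl (sym (⟨$⟩ʳ-injective σ σi≡σa)) a<i)
  ...       | tri> _ _ σa<σi =
    ⊥-elim (proj₂ allowable a i p a<i i<p σa<σi (ascent-reflected i<p γi<γp) (γi<γp , γp<γa))

module Potential (n : ℕ) (σ₁ σ₂ : Permutation′ n) (allowable : Allowable σ₁ σ₂) where
  open Allowability σ₁ σ₂ allowable

  value₁ value₂ : Fin n → ℕ
  value₁ i = toℕ (σ₁ ⟨$⟩ʳ i)
  value₂ i = toℕ (σ₂ ⟨$⟩ʳ i)

  upper : Fin n → List (Fin n)
  upper r = filter (λ a → σ₂ ⟨$⟩ʳ r ≤? σ₂ ⟨$⟩ʳ a) (allFin n)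

  μ : Fin n → ℕ
  μ r = min n (map value₁ (upper r))

  μ≤value₁ : ∀ r → μ r ≤ value₁ r
  μ≤value₁ r = All.lookup (min≤xs n (map value₁ (upper r)))
                          (∈-map⁺ value₁ (∈-filter⁺ _ (∈-allFin r) ℕ.≤-refl))

  μ-mono : ∀ {i p} → value₂ i < value₂ p → μ i ≤ μ p
  μ-mono {i} {p} σ₂i<σ₂p = min-mono-⊆ ℕ.≤-refl (Subset.map⁺ value₁ upper-p⊆upper-i)
    where
    upper-p⊆upper-i : upper p ⊆ upper i
    upper-p⊆upper-i = filter⁺′ _ _ (ℕ.≤-trans (ℕ.<⇒≤ σ₂i<σ₂p)) {allFin n} Subset.⊆-refl

  value₁<μ : ∀ {i p} → i Fin.< p → value₂ i < value₂ p → value₁ i < μ p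
  value₁<μ i<p σ₂i<σ₂p =
    v<min⁺ (toℕ<n (σ₁ ⟨$⟩ʳ _))
           (map⁺ (All.map (ascent-below-upper-set i<p σ₂i<σ₂p) (all-filter _ (allFin n))))

  potential : Vertex n 2 → ℕ × ℕ
  potential (i , Fin.zero)  = value₁ i , n
  potential (r , Fin.suc _) = μ r , value₂ r

  edge-decreasing : ∀ {v w} → Edge (pair σ₁ σ₂) v w → potential w <ₗₑₓ potential v
  edge-decreasing (horizontal i Fin.zero (Fin.suc Fin.zero) _) =
    ≤-<⇒<ₗₑₓ (μ≤value₁ i) (toℕ<n (σ₂ ⟨$⟩ʳ i))
  edge-decreasing (vertical p i Fin.zero _ σ₁i<σ₁p) = inj₁ σ₁i<σ₁p
  edge-decreasing (vertical p i (Fin.suc Fin.zero) _ σ₂i<σ₂p) =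
    ≤-<⇒<ₗₑₓ (μ-mono σ₂i<σ₂p) σ₂i<σ₂p
  edge-decreasing (diagonal p i (Fin.suc Fin.zero) Fin.zero _ i<p σ₂i<σ₂p) =
    inj₁ (value₁<μ i<p σ₂i<σ₂p)

theorem5p4 : (n : ℕ) (σ₁ σ₂ : Permutation′ n) →
             Allowable σ₁ σ₂ → ¬ HasDirectedCycle (pair σ₁ σ₂)
theorem5p4 n σ₁ σ₂ allowable (_ , cycle) = acyclic Lex potential edge-decreasing cycle
  where open Potential n σ₁ σ₂ allowable
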